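{- Let $\Delta_{sf}\ne1$ be a squarefree integer, let $k=1,2,3$ according as $\Delta_{sf}\equiv1,3,2\bmod4$, and let $\psi_{2^k}$ be: $\psi_2=\varepsilon$ if $\Delta_{sf}\equiv1\bmod4$; $\psi_4=\chi_4(\det)\varepsilon$ if $\Delta_{sf}\equiv3\bmod4$; $\psi_8=\chi_8(\det)\varepsilon$ if $\Delta_{sf}\equiv2\bmod8$; $\psi_8=\chi_4(\det)\chi_8(\det)\varepsilon$ if $\Delta_{sf}\equiv6\bmod8$. Let $\Phi_{2^k}=\{g\in GL_2(\mathbb{Z}/2^k\mathbb{Z}):\det(1-g)\in(\mathbb{Z}/2^k\mathbb{Z})^*\}$. Then \[ |\psi_{2^k}^{ -1}(1)\cap\Phi_{2^k}|-|\psi_{2^k}^{ -1}(-1)\cap\Phi_{2^k}|=\begin{cases}2&\text{if }k=1,\\0&\text{if }k\in\{2,3\}.\end{cases} \]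
   Context: $\varepsilon:GL_2(\mathbb{Z}/2^k\mathbb{Z})\to\{\pm1\}$ is reduction mod 2 to $GL_2(\mathbb{Z}/2\mathbb{Z})\cong S_3$ (acting on the three nonzero vectors of $(\mathbb{Z}/2\mathbb{Z})^2$) followed by the sign. $\chi_4$ is the nontrivial Dirichlet character mod 4; $\chi_8(d)=(-1)^{(d^2-1)/8}$ for odd $d$. -}

module Defs where

open import Data.Nat as ℕ using (ℕ; zero; suc; _≡ᵇ_)
open import Data.Nat.Properties using (m^n≢0)
open import Data.Nat.Divisibility using (_∣_)
open import Data.Integer as ℤ using (ℤ; +_; -_; _%ℕ_; ∣_∣)
open import Data.Integer.Properties using (_≟_)
open import Data.Fin using (Fin; toℕ)
open import Data.List using (List; []; _∷_; concatMap; map; filter; length; upTo; allFin)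
open import Data.Bool.ListAction using (any)
open import Data.Bool using (Bool; true; false; if_then_else_; _∧_)
open import Relation.Binary.PropositionalEquality using (_≡_)

-- Z/2^k Z is represented by the residues 0 .. 2^k - 1, i.e. by Fin (2 ^ k).
modulus : ℕ → ℕ
modulus k = 2 ℕ.^ k

red : (k : ℕ) → ℤ → ℕ
red k x = _%ℕ_ x (modulus k) {{m^n≢0 2 k}}

isUnit : (k : ℕ) → ℕ → Bool
isUnit k x = any (λ y → red k (+ (x ℕ.* y)) ≡ᵇ 1) (upTo (modulus k))

-- 2x2 matrix [[a , b] , [c , d]] over Z/2^k Z
record Mat (k : ℕ) : Set where
  constructor mat
  field
    a b c d : Fin (modulus k)

allMat : (k : ℕ) → List (Mat k)
allMat k = concatMap (λ a → concatMap (λ b → concatMap (λ c → map (λ d → mat a b c d)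
             (allFin _)) (allFin _)) (allFin _)) (allFin _)

ent : {k : ℕ} → Fin (modulus k) → ℤ
ent x = + toℕ x

det : {k : ℕ} → Mat k → ℕ
det {k} (mat a b c d) = red k (ent {k} a ℤ.* ent {k} d ℤ.- ent {k} b ℤ.* ent {k} c)

det1- : {k : ℕ} → Mat k → ℕ
det1- {k} (mat a b c d) =
  red k ((+ 1 ℤ.- ent {k} a) ℤ.* (+ 1 ℤ.- ent {k} d) ℤ.- (ℤ.- ent {k} b) ℤ.* (ℤ.- ent {k} c))

inGL : {k : ℕ} → Mat k → Bool
inGL {k} g = isUnit k (det g)

inΦ : {k : ℕ} → Mat k → Bool
inΦ {k} g = inGL g ∧ isUnit k (det1- g)

-- ε : reduce mod 2, act on the three nonzero vectors of F_2^2, take the sign.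
-- nonzero vectors indexed 0 ↦ (1,0), 1 ↦ (0,1), 2 ↦ (1,1)  (column vectors)
vx : ℕ → ℕ
vx 1 = 0
vx _ = 1

vy : ℕ → ℕ
vy 0 = 0
vy _ = 1

-- index of the vector (x , y) ∈ F_2^2 (x,y ∈ {0,1}); the zero vector
-- (which never occurs for g ∈ GL_2) is sent to 0
idx : ℕ → ℕ → ℕ
idx 1 0 = 0
idx 0 1 = 1
idx 1 1 = 2
idx _ _ = 0

perm : {k : ℕ} → Mat k → ℕ → ℕ
perm (mat a b c d) i =
  let a' = toℕ a ℕ.% 2 ; b' = toℕ b ℕ.% 2 ; c' = toℕ c ℕ.% 2 ; d' = toℕ d ℕ.% 2
      x' = vx i ; y' = vy i
  in idx ((a' ℕ.* x' ℕ.+ b' ℕ.* y') ℕ.% 2) ((c' ℕ.* x' ℕ.+ d' ℕ.* y') ℕ.% 2)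

inv : ℕ → ℕ → ℕ
inv p q = if q ℕ.<ᵇ p then 1 else 0

sgn3 : (ℕ → ℕ) → ℤ
sgn3 σ = if (inv (σ 0) (σ 1) ℕ.+ inv (σ 0) (σ 2) ℕ.+ inv (σ 1) (σ 2)) ℕ.% 2 ≡ᵇ 0
         then + 1 else - (+ 1)

ε : {k : ℕ} → Mat k → ℤ
ε g = sgn3 (perm g)

χ4 : ℕ → ℤ
χ4 n = if n ℕ.% 4 ≡ᵇ 1 then + 1 else (if n ℕ.% 4 ≡ᵇ 3 then - (+ 1) else + 0)

χ8 : ℕ → ℤ
χ8 n = if n ℕ.% 2 ≡ᵇ 0 then + 0
       else (if ((n ℕ.* n ℕ.∸ 1) ℕ./ 8) ℕ.% 2 ≡ᵇ 0 then + 1 else - (+ 1))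

-- k = 1, 2, 3 according as Δ ≡ 1, 3, 2 mod 4 (the value for Δ ≡ 0 mod 4 is irrelevant:
-- excluded by squarefreeness)
kOf : ℤ → ℕ
kOf Δ with Δ %ℕ 4
... | 1 = 1
... | 3 = 2
... | 2 = 3
... | _ = 1

ψ : ℤ → (k : ℕ) → Mat k → ℤ
ψ Δ k g with Δ %ℕ 4 | Δ %ℕ 8
... | 1 | _ = ε g
... | 3 | _ = χ4 (det g) ℤ.* ε g
... | 2 | 2 = χ8 (det g) ℤ.* ε g
... | 2 | 6 = χ4 (det g) ℤ.* χ8 (det g) ℤ.* ε g
... | _ | _ = ε g

countPre : ℤ → (k : ℕ) → ℤ → ℕ
countPre Δ k s = length (filter (λ g → ψ Δ k g ≟ s) (Data.List.filterᵇ (inΦ {k}) (allMat k)))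

SquareFree : ℤ → Set
SquareFree Δ = (n : ℕ) → (n ℕ.* n) ∣ ∣ Δ ∣ → n ≡ 1

rhs : ℕ → ℤ
rhs 1 = + 2
rhs _ = + 0

module Submission where

-- Every ingredient of the statement depends on Δ only through
-- its residues modulo 4 and 8: they select the level k and the character ψ_{2^k}.
-- After this reduction, each of the four cases (Δ ≡ 1, 3 mod 4; Δ ≡ 2, 6 mod 8)
-- is a statement about one explicit ±1-valued function on the finite set
-- Φ_{2^k} ⊆ GL_2(Z/2^k Z), and its signed count is evaluated by enumerating the
-- 2^{4k} matrices.

open import Defs
open import Data.Nat as ℕ using (ℕ; zero; suc; s≤s; NonZero)
open import Data.Nat.Properties using (1+n≢n)
open import Data.Nat.DivMod using (m∣n⇒o%n%m≡o%m; m%n<n)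
open import Data.Nat.Divisibility using (_∣_; divides)
open import Data.Integer as ℤ using (ℤ; +_; -_; _-_; _%ℕ_; _/ℕ_; -[1+_]; ∣_∣)
open import Data.Integer.DivMod using (n%ℕd<d; a≡a%ℕn+[a/ℕn]*n)
open import Data.Integer.Properties using (_≟_; abs-*; +-identityˡ)
open import Data.List using (filter; filterᵇ; length)
open import Data.Sum using (_⊎_; inj₁; inj₂)
open import Data.Empty using (⊥-elim)
open import Relation.Binary.PropositionalEquality
open ≡-Reasoning

count : (k : ℕ) → (Mat k → ℤ) → ℤ → ℕ
count k f s = length (filter (λ g → f g ≟ s) (filterᵇ (inΦ {k}) (allMat k)))

signedCount : (k : ℕ) → (Mat k → ℤ) → ℤ
signedCount k f = (+ count k f (+ 1)) - (+ count k f (- (+ 1)))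

ψ₄ : Mat 2 → ℤ
ψ₄ g = χ4 (det g) ℤ.* ε g

ψ₈ : Mat 3 → ℤ
ψ₈ g = χ8 (det g) ℤ.* ε g

ψ₈′ : Mat 3 → ℤ
ψ₈′ g = χ4 (det g) ℤ.* χ8 (det g) ℤ.* ε g

signedCount-ε : signedCount 1 ε ≡ + 2
signedCount-ε = refl

signedCount-ψ₄ : signedCount 2 ψ₄ ≡ + 0
signedCount-ψ₄ = refl

signedCount-ψ₈ : signedCount 3 ψ₈ ≡ + 0
signedCount-ψ₈ = refl

signedCount-ψ₈′ : signedCount 3 ψ₈′ ≡ + 0
signedCount-ψ₈′ = refl

-- The residue of -x modulo d, given the residue r of x modulo d.
negResidue : ℕ → ℕ → ℕ
negResidue d zero    = 0
negResidue d (suc r) = d ℕ.∸ suc r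

%ℕ-negsuc : ∀ n d .{{_ : NonZero d}} → -[1+ n ] %ℕ d ≡ negResidue d (suc n ℕ.% d)
%ℕ-negsuc n d with suc n ℕ.% d
... | zero  = refl
... | suc _ = refl

negResidue-mod8-mod4 : ∀ r → r ℕ.< 8 → negResidue 8 r ℕ.% 4 ≡ negResidue 4 (r ℕ.% 4)
negResidue-mod8-mod4 0 _ = refl
negResidue-mod8-mod4 1 _ = refl
negResidue-mod8-mod4 2 _ = refl
negResidue-mod8-mod4 3 _ = refl
negResidue-mod8-mod4 4 _ = refl
negResidue-mod8-mod4 5 _ = refl
negResidue-mod8-mod4 6 _ = refl
negResidue-mod8-mod4 7 _ = refl
negResidue-mod8-mod4 (suc (suc (suc (suc (suc (suc (suc (suc _))))))))
  (s≤s (s≤s (s≤s (s≤s (s≤s (s≤s (s≤s (s≤s ()))))))))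

mod8-mod4 : ∀ Δ → Δ %ℕ 8 ℕ.% 4 ≡ Δ %ℕ 4
mod8-mod4 (+ n)    = m∣n⇒o%n%m≡o%m 4 8 n (divides 2 refl)
mod8-mod4 -[1+ n ] = begin
  -[1+ n ] %ℕ 8 ℕ.% 4                 ≡⟨ cong (ℕ._% 4) (%ℕ-negsuc n 8) ⟩
  negResidue 8 (suc n ℕ.% 8) ℕ.% 4    ≡⟨ negResidue-mod8-mod4 _ (m%n<n (suc n) 8) ⟩
  negResidue 4 (suc n ℕ.% 8 ℕ.% 4)    ≡⟨ cong (negResidue 4) (m∣n⇒o%n%m≡o%m 4 8 (suc n) (divides 2 refl)) ⟩
  negResidue 4 (suc n ℕ.% 4)          ≡⟨ %ℕ-negsuc n 4 ⟨
  -[1+ n ] %ℕ 4                       ∎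

residue-over-2 : ∀ r → r ℕ.< 8 → r ℕ.% 4 ≡ 2 → r ≡ 2 ⊎ r ≡ 6
residue-over-2 2 _ _ = inj₁ refl
residue-over-2 6 _ _ = inj₂ refl
residue-over-2 0 _ ()
residue-over-2 1 _ ()
residue-over-2 3 _ ()
residue-over-2 4 _ ()
residue-over-2 5 _ ()
residue-over-2 7 _ ()
residue-over-2 (suc (suc (suc (suc (suc (suc (suc (suc _))))))))
  (s≤s (s≤s (s≤s (s≤s (s≤s (s≤s (s≤s (s≤s ())))))))) _

mod8-over-2 : ∀ Δ → Δ %ℕ 4 ≡ 2 → Δ %ℕ 8 ≡ 2 ⊎ Δ %ℕ 8 ≡ 6
mod8-over-2 Δ Δ≡2 = residue-over-2 (Δ %ℕ 8) (n%ℕd<d Δ 8) (trans (mod8-mod4 Δ) Δ≡2)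

%ℕ≡0⇒∣ : ∀ Δ d .{{_ : NonZero d}} → Δ %ℕ d ≡ 0 → d ∣ ∣ Δ ∣
%ℕ≡0⇒∣ Δ d Δ≡0 = divides ∣ q ∣ (begin
  ∣ Δ ∣                        ≡⟨ cong ∣_∣ (a≡a%ℕn+[a/ℕn]*n Δ d) ⟩
  ∣ + (Δ %ℕ d) ℤ.+ q ℤ.* + d ∣ ≡⟨ cong (λ r → ∣ + r ℤ.+ q ℤ.* + d ∣) Δ≡0 ⟩
  ∣ + 0 ℤ.+ q ℤ.* + d ∣        ≡⟨ cong ∣_∣ (+-identityˡ (q ℤ.* + d)) ⟩
  ∣ q ℤ.* + d ∣                ≡⟨ abs-* q (+ d) ⟩
  ∣ q ∣ ℕ.* d                  ∎)
  where q = Δ /ℕ d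

-- Lemma 5.9.  Once the residues of Δ mod 4 and 8 are fixed, the level kOf Δ and the
-- character ψ Δ reduce, and the left side is literally one of the four signed counts.
lemma5p9 : (Δ : ℤ) → SquareFree Δ → Δ ≢ + 1 →
    (+ countPre Δ (kOf Δ) (+ 1)) - (+ countPre Δ (kOf Δ) (- (+ 1))) ≡ rhs (kOf Δ)
lemma5p9 Δ squarefree _ with Δ %ℕ 4 in Δ≡r | n%ℕd<d Δ 4
... | 0 | _ = ⊥-elim (1+n≢n (squarefree 2 (%ℕ≡0⇒∣ Δ 4 Δ≡r)))
... | 1 | _ = signedCount-ε
... | 3 | _ = signedCount-ψ₄
... | suc (suc (suc (suc _))) | s≤s (s≤s (s≤s (s≤s ())))
... | 2 | _ with Δ %ℕ 8 | mod8-over-2 Δ Δ≡r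
...   | .2 | inj₁ refl = signedCount-ψ₈
...   | .6 | inj₂ refl = signedCount-ψ₈′
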